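{- If $G$ is a $k$-tree, then $\chi_{\text{lid}}(G)\leq 2k+2$.
   Context: A $k$-tree is a graph whose vertices can be ordered $v_1,\dots,v_n$ such that $v_1,\dots,v_{k+1}$ induce a clique on $k+1$ vertices and for each $k+2\le i\le n$ the neighbors of $v_i$ among $\{v_j: j<i\}$ induce a clique on $k$ vertices. For a vertex $u$, $N[u]$ is its closed neighborhood; for a coloring $c$ and vertex set $S$, $c(S)$ is the set of colors on $S$. A lid-coloring of $G$ is a proper vertex-coloring $c$ such that for every edge $uv$ with $N[u]\neq N[v]$, $c(N[u])\neq c(N[v])$; $\chi_{\text{lid}}(G)$ is the minimum number of colors in a lid-coloring of $G$. -}

module Defs where

open import Data.Nat using (ℕ; suc; _+_; _*_; _<_; _≤_)
open import Data.Fin using (Fin; toℕ)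
open import Data.Bool using (Bool; true)
open import Data.Sum using (_⊎_)
open import Data.Product using (Σ; ∃; _×_; _,_)
open import Relation.Binary.PropositionalEquality using (_≡_; _≢_)
open import Relation.Nullary using (¬_)
open import Function.Bundles using (_⇔_)
open import Function.Definitions using (Injective; Bijective)

record Graph : Set where
  field
    n      : ℕ
    adj    : Fin n → Fin n → Bool
    sym    : ∀ u v → adj u v ≡ adj v u
    irrefl : ∀ u → ¬ (adj u u ≡ true)

module _ (G : Graph) where
  open Graph G

  Adj : Fin n → Fin n → Set
  Adj u v = adj u v ≡ true

  -- A k-tree: there is an ordering v_0, …, v_{n-1} of the vertices
  -- (a bijection ord : Fin n → Fin n, v_i = ord i) such that
  --  * there are at least k+1 vertices and v_0,…,v_k are pairwise adjacent,
  --  * for every i ≥ k+1, the neighbours of v_i among earlier vertices form a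
  --    clique on exactly k vertices (given as the image of an injective
  --    map f : Fin k → Fin n, pairwise adjacent).
  record IsKTree (k : ℕ) : Set where
    field
      ord       : Fin n → Fin n
      ord-bij   : Bijective _≡_ _≡_ ord
      enough    : suc k ≤ n
      initClique : ∀ (i j : Fin n) → toℕ i < suc k → toℕ j < suc k →
                   i ≢ j → Adj (ord i) (ord j)
      backNbrs  : ∀ (i : Fin n) → suc k ≤ toℕ i →
                  Σ (Fin k → Fin n) λ f →
                    Injective _≡_ _≡_ f ×
                    (∀ (j : Fin n) → ((toℕ j < toℕ i) × Adj (ord j) (ord i))
                                     ⇔ (∃ λ t → f t ≡ ord j)) ×
                    (∀ s t → s ≢ t → Adj (f s) (f t))

  N[_] : Fin n → Fin n → Set
  N[ u ] w = (w ≡ u) ⊎ Adj u w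

  colsN : ∀ {m} → (Fin n → Fin m) → Fin n → Fin m → Set
  colsN c u x = ∃ λ w → N[ u ] w × c w ≡ x

  IsProper : ∀ {m} → (Fin n → Fin m) → Set
  IsProper c = ∀ u v → Adj u v → c u ≢ c v

  IsLidColoring : ∀ {m} → (Fin n → Fin m) → Set
  IsLidColoring {m} c =
    IsProper c ×
    (∀ u v → Adj u v →
       ¬ (∀ w → N[ u ] w ⇔ N[ v ] w) →
       ¬ (∀ x → colsN c u x ⇔ colsN c v x))

  χlid≤ : ℕ → Set
  χlid≤ m = Σ (Fin n → Fin m) IsLidColoring

module Submission where

-- Every vertex v beyond the
-- initial (k+1)-clique has a back clique of k earlier neighbours, and that
-- clique extends, inside the prefix before v, to a (k+1)-clique by one more
-- vertex, the mate of v.  Colour the initial vertices by their positions with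
-- side false, and let every later vertex copy the class of its mate and take
-- the opposite side.  The class is a proper (k+1)-colouring, so the pair
-- (class, side) is a proper colouring with 2k+2 colours.
--
-- For the lid condition we show, by induction along the ordering, that every
-- edge uv either has N[u] = N[v] or has a separator: a neighbour of one
-- endpoint with the class of the other endpoint but the opposite side.  Its
-- colour then occurs around one endpoint and nowhere around the other.  The
-- induction step needs that a k-tree has no (k+2)-clique.

open import Defs
open import Data.Nat using (ℕ; _+_; _*_)
open import Data.Nat using (zero; suc; _≤_; _<_; z≤n; s≤s⁻¹; _≤?_; _≟_)
open import Data.Nat.Properties
  using (≤-refl; <⇒≤; <-≤-trans; ≤∧≢⇒<; m<n⇒m<1+n; ≰⇒>; n<1+n; n≮0; 1+n≰n;
         <-irrefl; <-trans; <-cmp; ≤-irrelevant)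
open import Data.Nat.Tactic.RingSolver using (solve-∀)
open import Data.Fin using (Fin; zero; suc; toℕ; fromℕ<; cast; join; splitAt; punchIn; punchOut)
open import Data.Fin.Properties
  using (toℕ-injective; toℕ-fromℕ<; toℕ<n; toℕ-cast; splitAt-join; any?; all?;
         ¬∀⟶∃¬; injective⇒≤; <⇒notInjective; punchIn-injective; punchInᵢ≢i;
         punchOut-injective)
  renaming (_≟_ to _≟ᶠ_)
open import Data.Bool using (Bool; true; false; not)
open import Data.Bool.Properties using (not-¬) renaming (_≟_ to _≟ᵇ_)
open import Data.Sum using (_⊎_; inj₁; inj₂)
open import Data.Product using (Σ; ∃; _×_; _,_; proj₁; proj₂)
open import Data.Empty using (⊥; ⊥-elim)
open import Relation.Nullary using (¬_; Dec; yes; no)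
open import Relation.Binary.Definitions using (tri<; tri≈; tri>)
open import Relation.Binary.PropositionalEquality
  using (_≡_; _≢_; refl; sym; trans; cong; subst; subst₂; module ≡-Reasoning)
open import Function using (_∘_)
open import Function.Bundles using (_⇔_; mk⇔; Equivalence)
import Function.Properties.Equivalence as ⇔
open import Function.Definitions using (Injective)

open ≡-Reasoning

injection-hits : ∀ {r} (g : Fin r → Fin r) → Injective _≡_ _≡_ g →
                 ∀ s₀ → ¬ (∀ t → g t ≢ s₀)
injection-hits {suc r} g g-inj s₀ misses =
  <⇒notInjective {f = λ t → punchOut (misses t ∘ sym)} (n<1+n r)
    (λ e → g-inj (punchOut-injective (misses _ ∘ sym) (misses _ ∘ sym) e))

Palette : ℕ → Set
Palette k = Fin (suc k) × Bool

flip : ∀ {k} → Palette k → Palette k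
flip (x , b) = x , not b

asSum : ∀ {k} → Palette k → Fin (suc k) ⊎ Fin (suc k)
asSum (x , false) = inj₁ x
asSum (x , true)  = inj₂ x

asSum-injective : ∀ {k} → Injective _≡_ _≡_ (asSum {k})
asSum-injective {x = _ , false} {_ , false} refl = refl
asSum-injective {x = _ , false} {_ , true}  ()
asSum-injective {x = _ , true}  {_ , false} ()
asSum-injective {x = _ , true}  {_ , true}  refl = refl

palette-size : ∀ k → suc k + suc k ≡ 2 * k + 2
palette-size = solve-∀

encode : ∀ {k} → Palette k → Fin (2 * k + 2)
encode {k} c = cast (palette-size k) (join (suc k) (suc k) (asSum c))

encode-injective : ∀ {k} → Injective _≡_ _≡_ (encode {k})
encode-injective {k} {c} {d} e = asSum-injective (begin
  asSum c                        ≡⟨ sym (splitAt-join (suc k) (suc k) (asSum c)) ⟩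
  splitAt (suc k) (joined c)     ≡⟨ cong (splitAt (suc k)) same-join ⟩
  splitAt (suc k) (joined d)     ≡⟨ splitAt-join (suc k) (suc k) (asSum d) ⟩
  asSum d                        ∎)
  where
  joined : Palette k → Fin (suc k + suc k)
  joined x = join (suc k) (suc k) (asSum x)

  same-join : joined c ≡ joined d
  same-join = toℕ-injective (begin
    toℕ (joined c)     ≡⟨ sym (toℕ-cast (palette-size k) (joined c)) ⟩
    toℕ (encode c)     ≡⟨ cong toℕ e ⟩
    toℕ (encode d)     ≡⟨ toℕ-cast (palette-size k) (joined d) ⟩
    toℕ (joined d)     ∎)

below-≢ : ∀ {a m} → a < suc m → a ≢ m → a < m
below-≢ a<1+m a≢m = ≤∧≢⇒< (s≤s⁻¹ a<1+m) a≢m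

module KTreeColouring (k : ℕ) (G : Graph) (T : IsKTree G k) where
  open Graph G using (n; adj) renaming (sym to adj-sym)
  open IsKTree T

  _∼_ : Fin n → Fin n → Set
  u ∼ v = Adj G u v

  ∼-sym : ∀ {u v} → u ∼ v → v ∼ u
  ∼-sym {u} {v} uv = trans (adj-sym v u) uv

  ∼-irrefl : ∀ {u v} → u ∼ v → u ≢ v
  ∼-irrefl {u} uv refl = Graph.irrefl G u uv

  _∼?_ : ∀ u v → Dec (u ∼ v)
  u ∼? v = adj u v ≟ᵇ true

  N : Fin n → Fin n → Set
  N = N[_] G

  position : Fin n → Fin n
  position v = proj₁ (proj₂ ord-bij v)

  ord-position : ∀ v → ord (position v) ≡ v
  ord-position v = proj₂ (proj₂ ord-bij v) refl

  position-ord : ∀ i → position (ord i) ≡ i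
  position-ord i = proj₁ ord-bij (ord-position (ord i))

  rank : Fin n → ℕ
  rank v = toℕ (position v)

  rank<n : ∀ v → rank v < n
  rank<n v = toℕ<n (position v)

  rank-injective : ∀ {u v} → rank u ≡ rank v → u ≡ v
  rank-injective {u} {v} e = begin
    u                 ≡⟨ sym (ord-position u) ⟩
    ord (position u)  ≡⟨ cong ord (toℕ-injective e) ⟩
    ord (position v)  ≡⟨ ord-position v ⟩
    v                 ∎

  vertexAt : ∀ {m} → m < n → Fin n
  vertexAt m<n = ord (fromℕ< m<n)

  rank-vertexAt : ∀ {m} (m<n : m < n) → rank (vertexAt m<n) ≡ m
  rank-vertexAt m<n = trans (cong toℕ (position-ord _)) (toℕ-fromℕ< m<n)

  ∼-of-positions : ∀ {u v} → ord (position u) ∼ ord (position v) → u ∼ v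
  ∼-of-positions {u} {v} = subst₂ _∼_ (ord-position u) (ord-position v)

  ∼-to-positions : ∀ {u v} → u ∼ v → ord (position u) ∼ ord (position v)
  ∼-to-positions {u} {v} = subst₂ _∼_ (sym (ord-position u)) (sym (ord-position v))

  initial-adjacent : ∀ {u v} → rank u < suc k → rank v < suc k → u ≢ v → u ∼ v
  initial-adjacent {u} {v} u<k v<k u≢v =
    ∼-of-positions (initClique (position u) (position v) u<k v<k
                      (u≢v ∘ rank-injective ∘ cong toℕ))

  record Clique (r m : ℕ) : Set where
    field
      member    : Fin r → Fin n
      injective : Injective _≡_ _≡_ member
      early     : ∀ s → rank (member s) < m
      adjacent  : ∀ s t → s ≢ t → member s ∼ member t

  open Clique

  Member : ∀ {r m} → Clique r m → Fin n → Set
  Member K w = ∃ λ s → member K s ≡ w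

  member? : ∀ {r m} (K : Clique r m) w → Dec (Member K w)
  member? K w = any? (λ s → member K s ≟ᶠ w)

  indices : ∀ {q r m} (K : Clique r m) (f : Fin q → Fin n) →
            (∀ x → Member K (f x)) → Fin q → Fin r
  indices K f inside x = proj₁ (inside x)

  indices-injective : ∀ {q r m} (K : Clique r m) (f : Fin q → Fin n) →
                      Injective _≡_ _≡_ f → (inside : ∀ x → Member K (f x)) →
                      Injective _≡_ _≡_ (indices K f inside)
  indices-injective K f f-inj inside {x} {y} e = f-inj (begin
    f x                                ≡⟨ sym (proj₂ (inside x)) ⟩
    member K (indices K f inside x)    ≡⟨ cong (member K) e ⟩
    member K (indices K f inside y)    ≡⟨ proj₂ (inside y) ⟩
    f y                                ∎)

  lowerClique : ∀ {r m} (K : Clique r (suc m)) →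
                (∀ s → rank (member K s) ≢ m) → Clique r m
  lowerClique K avoids = record
    { member = member K ; injective = injective K
    ; early = λ s → below-≢ (early K s) (avoids s) ; adjacent = adjacent K }

  below-top : ∀ {r m} (K : Clique r (suc m)) {s t} →
              rank (member K t) ≡ m → s ≢ t → rank (member K s) < rank (member K t)
  below-top K {s} {t} top s≢t =
    subst (rank (member K s) <_) (sym top)
      (below-≢ (early K s) (λ e → s≢t (injective K (rank-injective (trans e (sym top))))))

  record Completion {r m} (K : Clique r m) : Set where
    field
      apex          : Fin n
      apex-early    : rank apex < m
      apex-adjacent : ∀ s → member K s ∼ apex
      apex-new      : ∀ s → member K s ≢ apex

  open Completion

  extendClique : ∀ {r m} (K : Clique r m) → Completion K → Clique (suc r) m
  extendClique {r} {m} K C = record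
    { member = extended ; injective = extended-injective
    ; early = extended-early ; adjacent = extended-adjacent }
    where
    extended : Fin (suc r) → Fin n
    extended zero    = apex C
    extended (suc s) = member K s

    extended-injective : Injective _≡_ _≡_ extended
    extended-injective {zero}  {zero}  _ = refl
    extended-injective {zero}  {suc t} e = ⊥-elim (apex-new C t (sym e))
    extended-injective {suc s} {zero}  e = ⊥-elim (apex-new C s e)
    extended-injective {suc s} {suc t} e = cong suc (injective K e)

    extended-early : ∀ s → rank (extended s) < m
    extended-early zero    = apex-early C
    extended-early (suc s) = early K s

    extended-adjacent : ∀ s t → s ≢ t → extended s ∼ extended t
    extended-adjacent zero    zero    s≢t = ⊥-elim (s≢t refl)
    extended-adjacent zero    (suc t) _   = ∼-sym (apex-adjacent C t)
    extended-adjacent (suc s) zero    _   = apex-adjacent C s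
    extended-adjacent (suc s) (suc t) s≢t = adjacent K s t (s≢t ∘ cong suc)

  few-below : ∀ {r b} (f : Fin r → Fin n) → Injective _≡_ _≡_ f →
              (∀ s → rank (f s) < b) → r ≤ b
  few-below f f-inj below = injective⇒≤ {f = λ s → fromℕ< (below s)}
    (λ {x} {y} e → f-inj (rank-injective (begin
      rank (f x)               ≡⟨ sym (toℕ-fromℕ< (below x)) ⟩
      toℕ (fromℕ< (below x))   ≡⟨ cong toℕ e ⟩
      toℕ (fromℕ< (below y))   ≡⟨ toℕ-fromℕ< (below y) ⟩
      rank (f y)               ∎)))

  record BackClique (v : Fin n) : Set where
    field
      clique   : Clique k (rank v)
      toV      : ∀ s → member clique s ∼ v
      complete : ∀ w → rank w < rank v → w ∼ v → Member clique w

  backClique : ∀ v → suc k ≤ rank v → BackClique v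
  backClique v k<v with backNbrs (position v) k<v
  ... | f , f-inj , earlier⇔member , f-adjacent = record
    { clique = record { member = f ; injective = f-inj
                      ; early = proj₁ ∘ earlier ; adjacent = f-adjacent }
    ; toV = ∼-of-positions ∘ proj₂ ∘ earlier
    ; complete = λ w w<v wv →
        let (s , e) = Equivalence.to (earlier⇔member (position w)) (w<v , ∼-to-positions wv)
        in s , trans e (ord-position w) }
    where
    earlier : ∀ s → rank (f s) < rank v × ord (position (f s)) ∼ ord (position v)
    earlier s = Equivalence.from (earlier⇔member (position (f s))) (s , sym (ord-position (f s)))

  earlier-neighbours : ∀ {r} v → suc k ≤ rank v → (f : Fin r → Fin n) →
                       Injective _≡_ _≡_ f → (∀ s → rank (f s) < rank v) →
                       (∀ s → f s ∼ v) → r ≤ k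
  earlier-neighbours v k<v f f-inj earlier adjacent-v =
    injective⇒≤ (indices-injective clique f f-inj inside)
    where
    open BackClique (backClique v k<v)
    inside : ∀ s → Member clique (f s)
    inside s = complete (f s) (earlier s) (adjacent-v s)

  -- A k-tree has no (k+2)-clique: within the initial clique by counting, and
  -- otherwise the latest member would have k+1 earlier neighbours.
  no-large-clique : ∀ m → ¬ Clique (2 + k) m
  no-large-clique zero K = n≮0 (early K zero)
  no-large-clique (suc m) K with suc k ≤? m | any? (λ s → rank (member K s) ≟ m)
  ... | no m≤k | _ =
    1+n≰n (few-below (member K) (injective K) (λ s → <-≤-trans (early K s) (≰⇒> m≤k)))
  ... | yes _ | no avoids = no-large-clique m (lowerClique K (λ s e → avoids (s , e)))
  ... | yes k<m | yes (t , top) =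
    1+n≰n (earlier-neighbours (member K t) (subst (suc k ≤_) (sym top) k<m)
             (member K ∘ punchIn t)
             (punchIn-injective t _ _ ∘ injective K)
             (λ s → below-top K top (punchInᵢ≢i t s))
             (λ s → adjacent K (punchIn t s) t (punchInᵢ≢i t s)))

  -- Completion in the initial clique: some initial vertex is not a member.
  initial-completion : ∀ {m} (K : Clique k m) → m ≤ suc k → suc k ≤ m → Completion K
  initial-completion K m≤k+1 k+1≤m = choose (all? (λ x → member? K (initial x)))
    where
    exists : ∀ (x : Fin (suc k)) → toℕ x < n
    exists x = <-≤-trans (toℕ<n x) enough

    initial : Fin (suc k) → Fin n
    initial x = vertexAt (exists x)

    rank-initial : ∀ x → rank (initial x) < suc k
    rank-initial x = subst (_< suc k) (sym (rank-vertexAt (exists x))) (toℕ<n x)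

    initial-injective : Injective _≡_ _≡_ initial
    initial-injective {x} {y} e = toℕ-injective (begin
      toℕ x              ≡⟨ sym (rank-vertexAt (exists x)) ⟩
      rank (initial x)   ≡⟨ cong rank e ⟩
      rank (initial y)   ≡⟨ rank-vertexAt (exists y) ⟩
      toℕ y              ∎)

    choose : Dec (∀ x → Member K (initial x)) → Completion K
    choose (yes inside) = ⊥-elim (<⇒notInjective (n<1+n k)
                                     (indices-injective K initial initial-injective inside))
    choose (no ¬inside) with ¬∀⟶∃¬ _ _ (λ x → member? K (initial x)) ¬inside
    ... | x , outside = record
      { apex = initial x
      ; apex-early = <-≤-trans (rank-initial x) k+1≤m
      ; apex-adjacent = λ s → initial-adjacent (<-≤-trans (early K s) m≤k+1)
                                (rank-initial x) (λ e → outside (s , e))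
      ; apex-new = λ s e → outside (s , e) }

  -- Completion through the latest member z: a member of the back clique of z
  -- outside K exists by counting, and it is adjacent to all of K.
  top-completion : ∀ {m} (K : Clique k (suc m)) s₀ → rank (member K s₀) ≡ m →
                   suc k ≤ m → Completion K
  top-completion {m} K s₀ top k<m = choose (all? (λ t → member? K (B.member t)))
    where
    z : Fin n
    z = member K s₀

    module B where
      open BackClique (backClique z (subst (suc k ≤_) (sym top) k<m)) public
      open Clique clique public

    choose : Dec (∀ t → Member K (B.member t)) → Completion K
    choose (yes inside) = ⊥-elim (injection-hits (indices K B.member inside)
      (indices-injective K B.member B.injective inside) s₀
      (λ t e → <-irrefl (cong rank (trans (sym (proj₂ (inside t))) (cong (member K) e)))
                        (B.early t)))
    choose (no ¬inside) with ¬∀⟶∃¬ _ _ (λ t → member? K (B.member t)) ¬inside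
    ... | t , outside = record
      { apex = B.member t
      ; apex-early = m<n⇒m<1+n (subst (rank (B.member t) <_) top (B.early t))
      ; apex-adjacent = adjacent-outsider
      ; apex-new = λ s e → outside (s , e) }
      where
      adjacent-outsider : ∀ s → member K s ∼ B.member t
      adjacent-outsider s with s ≟ᶠ s₀
      ... | yes refl = ∼-sym (B.toV t)
      ... | no s≢s₀ with B.complete (member K s) (below-top K top s≢s₀) (adjacent K s s₀ s≢s₀)
      ...   | t′ , e = subst (_∼ B.member t) e
                         (B.adjacent t′ t (λ t′≡t → outside (s , trans (sym e) (cong B.member t′≡t))))

  widen : ∀ {r m} {K : Clique r (suc m)} {avoids} →
          Completion (lowerClique K avoids) → Completion K
  widen C = record { apex = apex C ; apex-early = m<n⇒m<1+n (apex-early C)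
                   ; apex-adjacent = apex-adjacent C ; apex-new = apex-new C }

  completion : ∀ m → suc k ≤ m → (K : Clique k m) → Completion K
  completion (suc m) k<1+m K with suc k ≤? m | any? (λ s → rank (member K s) ≟ m)
  ... | no m≤k | _ = initial-completion K (≰⇒> m≤k) k<1+m
  ... | yes k<m | no avoids = widen (completion m k<m (lowerClique K (λ s e → avoids (s , e))))
  ... | yes k<m | yes (s₀ , top) = top-completion K s₀ top k<m

  mateCompletion : ∀ v (p : suc k ≤ rank v) → Completion (BackClique.clique (backClique v p))
  mateCompletion v p = completion (rank v) p (BackClique.clique (backClique v p))

  mate : ∀ v → suc k ≤ rank v → Fin n
  mate v p = apex (mateCompletion v p)

  -- The colouring, computed along the ordering: fuel bounds the recursion, and
  -- any fuel exceeding the rank gives the same colour since mates are earlier.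
  colourWithin : ℕ → Fin n → Palette k
  colourWithin zero         v = zero , false  -- not reached with enough fuel
  colourWithin (suc fuel) v with suc k ≤? rank v
  ... | yes p        = flip (colourWithin fuel (mate v p))
  ... | no v-initial = fromℕ< (≰⇒> v-initial) , false

  colourWithin-stable : ∀ f g v → rank v < f → rank v < g → colourWithin f v ≡ colourWithin g v
  colourWithin-stable (suc f) (suc g) v v<f v<g with suc k ≤? rank v
  ... | yes p = cong flip (colourWithin-stable f g (mate v p)
                  (<-≤-trans (apex-early (mateCompletion v p)) (s≤s⁻¹ v<f))
                  (<-≤-trans (apex-early (mateCompletion v p)) (s≤s⁻¹ v<g)))
  ... | no _  = refl

  colour : Fin n → Palette k
  colour v = colourWithin (suc (rank v)) v

  class : Fin n → Fin (suc k)
  class v = proj₁ (colour v)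

  side : Fin n → Bool
  side v = proj₂ (colour v)

  colour-mate : ∀ v p → colour v ≡ flip (colour (mate v p))
  colour-mate v p with suc k ≤? rank v
  ... | yes p′ rewrite ≤-irrelevant p p′ =
    cong flip (colourWithin-stable _ _ _ (apex-early (mateCompletion v p′)) (n<1+n _))
  ... | no ¬p = ⊥-elim (¬p p)

  class-mate : ∀ v p → class v ≡ class (mate v p)
  class-mate v p = cong proj₁ (colour-mate v p)

  side-flips : ∀ v p → side v ≢ side (mate v p)
  side-flips v p e = not-¬ refl (trans (sym e) (cong proj₂ (colour-mate v p)))

  class-initial : ∀ v → rank v < suc k → toℕ (class v) ≡ rank v
  class-initial v v<k with suc k ≤? rank v
  ... | yes p = ⊥-elim (<-irrefl refl (<-≤-trans v<k p))
  ... | no _  = toℕ-fromℕ< _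

  -- For an edge uv with u earlier, u lies in
  -- the back clique of v, so it is adjacent to the mate of v, which has the
  -- class of v; recurse on that edge, which lies before v.
  class-proper-within : ∀ b {u v} → rank u < b → rank v < b → u ∼ v → class u ≢ class v
  class-proper-ordered : ∀ b {u v} → rank u < rank v → rank v < b → u ∼ v → class u ≢ class v

  class-proper-within b {u} {v} u<b v<b uv with <-cmp (rank u) (rank v)
  ... | tri< u<v _ _ = class-proper-ordered b u<v v<b uv
  ... | tri≈ _ e _   = ⊥-elim (∼-irrefl uv (rank-injective e))
  ... | tri> _ _ v<u = class-proper-ordered b v<u u<b (∼-sym uv) ∘ sym

  class-proper-ordered (suc b) {u} {v} u<v v<b uv = by-kind (suc k ≤? rank v)
    where
    by-kind : Dec (suc k ≤ rank v) → class u ≢ class v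
    by-kind (no v-initial) same = <-irrefl (begin
      rank u           ≡⟨ sym (class-initial u (<-trans u<v (≰⇒> v-initial))) ⟩
      toℕ (class u)    ≡⟨ cong toℕ same ⟩
      toℕ (class v)    ≡⟨ class-initial v (≰⇒> v-initial) ⟩
      rank v           ∎) u<v
    by-kind (yes p) same with BackClique.complete (backClique v p) u u<v uv
    ... | s , e = class-proper-within b
                    (<-≤-trans u<v (s≤s⁻¹ v<b))
                    (<-≤-trans (apex-early (mateCompletion v p)) (s≤s⁻¹ v<b))
                    (subst (_∼ mate v p) e (apex-adjacent (mateCompletion v p) s))
                    (trans same (class-mate v p))

  class-proper : ∀ {u v} → u ∼ v → class u ≢ class v
  class-proper {u} {v} = class-proper-within n (rank<n u) (rank<n v)

  -- A separator for the edge uv: a neighbour of v with the class of u and the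
  -- other side.  Its colour occurs around v but not around u.
  Separator : Fin n → Fin n → Set
  Separator u v = Σ (Fin n) λ l → v ∼ l × class l ≡ class u × side l ≢ side u

  AgreeBelow : ℕ → Fin n → Fin n → Set
  AgreeBelow m u v = ∀ w → rank w < m → N u w ⇔ N v w

  Resolution : ℕ → Fin n → Fin n → Set
  Resolution m u v = AgreeBelow m u v ⊎ (Separator u v ⊎ Separator v u)

  Resolved : ℕ → Set
  Resolved m = ∀ u v → rank u < m → rank v < m → u ∼ v → Resolution m u v

  -- Inside the initial clique every closed neighbourhood covers the prefix.
  initial-resolved : ∀ m → m ≤ suc k → Resolved m
  initial-resolved m m≤k+1 u v u<m v<m _ = inj₁ λ w w<m →
    mk⇔ (λ _ → covers v w v<m w<m) (λ _ → covers u w u<m w<m)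
    where
    covers : ∀ x w → rank x < m → rank w < m → N x w
    covers x w x<m w<m with w ≟ᶠ x
    ... | yes w≡x = inj₁ w≡x
    ... | no w≢x  = inj₂ (initial-adjacent (<-≤-trans x<m m≤k+1) (<-≤-trans w<m m≤k+1)
                            (w≢x ∘ sym))

  -- A new vertex is separated from each earlier neighbour by its mate.
  new-separator : ∀ u v (p : suc k ≤ rank u) → rank v < rank u → u ∼ v → Separator u v
  new-separator u v p v<u uv with BackClique.complete (backClique u p) v v<u (∼-sym uv)
  ... | s , e = mate u p
              , subst (_∼ mate u p) e (apex-adjacent (mateCompletion u p) s)
              , sym (class-mate u p)
              , side-flips u p ∘ sym

  -- If N[u] and N[v] agree before z, and z is adjacent to u but not to v, then
  -- the mate of z is v (otherwise v, the mate and the back clique of z form a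
  -- (k+2)-clique), so z separates v from u.
  flip-separator : ∀ z u v (p : suc k ≤ rank z) → rank u < rank z → rank v < rank z →
                   AgreeBelow (rank z) u v → u ∼ z → ¬ (v ∼ z) → Separator v u
  flip-separator z u v p u<z v<z agree uz ¬vz =
    z , uz , trans (class-mate z p) (cong class mate≡v) ,
    λ e → side-flips z p (trans e (cong side (sym mate≡v)))
    where
    open BackClique (backClique z p)
    M : Completion clique
    M = mateCompletion z p

    u-member : Member clique u
    u-member = complete u u<z uz

    -- the back clique of z lies in N[u], hence in N[v]
    members-around-u : ∀ s → N u (member clique s)
    members-around-u s with s ≟ᶠ proj₁ u-member
    ... | yes refl = inj₁ (proj₂ u-member)
    ... | no s≢sᵤ = inj₂ (subst (_∼ member clique s) (proj₂ u-member)
                            (adjacent clique _ s (s≢sᵤ ∘ sym)))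

    members-around-v : ∀ s → v ∼ member clique s
    members-around-v s with Equivalence.to (agree (member clique s) (early clique s))
                                           (members-around-u s)
    ... | inj₁ s≡v = ⊥-elim (¬vz (subst (_∼ z) s≡v (toV s)))
    ... | inj₂ vs  = vs

    V : Completion clique
    V = record { apex = v ; apex-early = v<z
               ; apex-adjacent = ∼-sym ∘ members-around-v
               ; apex-new = λ s e → ¬vz (subst (_∼ z) e (toV s)) }

    mate≡v : apex M ≡ v
    mate≡v with Equivalence.to (agree (apex M) (apex-early M))
                  (inj₂ (subst (_∼ apex M) (proj₂ u-member) (apex-adjacent M _)))
    ... | inj₁ e  = e
    ... | inj₂ va = ⊥-elim (no-large-clique (rank z) (extendClique (extendClique clique V) record
      { apex = apex M ; apex-early = apex-early M
      ; apex-adjacent = λ { zero → va ; (suc s) → apex-adjacent M s }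
      ; apex-new = λ { zero → ∼-irrefl va ; (suc s) → apex-new M s } }))

  extend-agreement : ∀ {u v} z → rank u < rank z → rank v < rank z →
                     AgreeBelow (rank z) u v → (u ∼ z → v ∼ z) → (v ∼ z → u ∼ z) →
                     AgreeBelow (suc (rank z)) u v
  extend-agreement z u<z v<z agree u→v v→u w w<1+z with rank w ≟ rank z
  ... | no w≢z = agree w (below-≢ w<1+z w≢z)
  ... | yes w≡z = mk⇔ (across u<z u→v) (across v<z v→u)
    where
    across : ∀ {x y} → rank x < rank z → (x ∼ z → y ∼ z) → N x w → N y w
    across x<z _   (inj₁ w≡x) = ⊥-elim (<-irrefl (trans (cong rank (sym w≡x)) w≡z) x<z)
    across _   x→y (inj₂ xw)  = inj₂ (subst (_ ∼_) (sym z≡w) (x→y (subst (_ ∼_) z≡w xw)))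
      where
      z≡w : w ≡ z
      z≡w = rank-injective w≡z

  -- An edge before z stays resolved once z is added: agreement survives unless
  -- z is adjacent to exactly one endpoint, and then z itself separates.
  old-edge : ∀ z → suc k ≤ rank z → ∀ {u v} → rank u < rank z → rank v < rank z →
             Resolution (rank z) u v → Resolution (suc (rank z)) u v
  old-edge z p u<z v<z (inj₂ separated) = inj₂ separated
  old-edge z p {u} {v} u<z v<z (inj₁ agree) with u ∼? z | v ∼? z
  ... | yes uz | yes vz = inj₁ (extend-agreement z u<z v<z agree (λ _ → vz) (λ _ → uz))
  ... | no ¬uz | no ¬vz = inj₁ (extend-agreement z u<z v<z agree (⊥-elim ∘ ¬uz) (⊥-elim ∘ ¬vz))
  ... | yes uz | no ¬vz = inj₂ (inj₂ (flip-separator z u v p u<z v<z agree uz ¬vz))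
  ... | no ¬uz | yes vz = inj₂ (inj₁ (flip-separator z v u p v<z u<z
                                        (λ w w<z → ⇔.sym (agree w w<z)) vz ¬uz))

  resolved-step : ∀ {m} z → rank z ≡ m → suc k ≤ m → Resolved m → Resolved (suc m)
  resolved-step z refl p resolved-before u v u<1+z v<1+z uv
    with rank u ≟ rank z | rank v ≟ rank z
  ... | yes u≡z | yes v≡z = ⊥-elim (∼-irrefl uv (rank-injective (trans u≡z (sym v≡z))))
  ... | yes u≡z | no v≢z  = inj₂ (inj₁ (new-separator u v (subst (suc k ≤_) (sym u≡z) p)
                                          (subst (rank v <_) (sym u≡z) (below-≢ v<1+z v≢z)) uv))
  ... | no u≢z  | yes v≡z = inj₂ (inj₂ (new-separator v u (subst (suc k ≤_) (sym v≡z) p)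
                                          (subst (rank u <_) (sym v≡z) (below-≢ u<1+z u≢z))
                                          (∼-sym uv)))
  ... | no u≢z  | no v≢z  = old-edge z p u<z v<z (resolved-before u v u<z v<z uv)
    where
    u<z : rank u < rank z
    u<z = below-≢ u<1+z u≢z
    v<z : rank v < rank z
    v<z = below-≢ v<1+z v≢z

  resolved : ∀ m → m ≤ n → Resolved m
  resolved zero    _     = initial-resolved zero z≤n
  resolved (suc m) m<n with suc k ≤? m
  ... | no m≤k  = initial-resolved (suc m) (≰⇒> m≤k)
  ... | yes k<m = resolved-step (vertexAt m<n) (rank-vertexAt m<n) k<m
                    (resolved m (<⇒≤ m<n))

  colouring : Fin n → Fin (2 * k + 2)
  colouring = encode ∘ colour

  -- The colour of a separator's vertex is missing around u: not at u (other
  -- side) and not at a neighbour of u (that would share the class of u).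
  separator-excludes : ∀ {u v} → Separator u v →
                       ¬ (∀ x → colsN G colouring v x → colsN G colouring u x)
  separator-excludes {u} {v} (l , vl , same-class , other-side) v⊆u
    with v⊆u (colouring l) (l , inj₂ vl , refl)
  ... | w , around-u , same-code = excluded around-u
    where
    same-colour : colour w ≡ colour l
    same-colour = encode-injective {x = colour w} {y = colour l} same-code

    excluded : N u w → ⊥
    excluded (inj₁ w≡u) = other-side (trans (sym (cong proj₂ same-colour)) (cong side w≡u))
    excluded (inj₂ uw)  = class-proper uw (trans (sym same-class) (sym (cong proj₁ same-colour)))

mainTheorem3 : (k : ℕ) (G : Graph) → IsKTree G k → χlid≤ G (2 * k + 2)
mainTheorem3 k G T = colouring , proper , lid
  where
  open KTreeColouring k G T

  proper : IsProper G colouring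
  proper u v uv same =
    class-proper uv (cong proj₁ (encode-injective {x = colour u} {y = colour v} same))

  lid : ∀ u v → Adj G u v → ¬ (∀ w → N[_] G u w ⇔ N[_] G v w) →
        ¬ (∀ x → colsN G colouring u x ⇔ colsN G colouring v x)
  lid u v uv different same with resolved (Graph.n G) ≤-refl u v (rank<n u) (rank<n v) uv
  ... | inj₁ agree         = different (λ w → agree w (rank<n w))
  ... | inj₂ (inj₁ u-sep)  = separator-excludes u-sep (Equivalence.from ∘ same)
  ... | inj₂ (inj₂ v-sep)  = separator-excludes v-sep (Equivalence.to ∘ same)
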